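{- Let $G$ be an Eulerian directed multigraph with $n$ vertices and $m$ edges, given with fixed orderings of incoming and outgoing edges at each vertex. Assume arithmetic and memory operations on $\lceil\lg m\rceil$-bit integers take constant time, and that $d^+(v)$, $d^-(v)$, $\Gamma^+(v,i)$ and $\Gamma^-(v,i)$ can each be evaluated in constant time. Then Algorithm \textsc{Space-Efficient-Hierholzer} (described in the context) terminates on $G$ in time $\mathrm{O}(m)$.
   Context: $G=(V,E)$ is a finite directed multigraph (loops and parallel edges allowed), $V=[n]$, $|E|=m$. $d^+(v)$, $d^-(v)$ are out- and in-degree. $G$ is Eulerian: strongly connected and $d^+(v)=d^-(v)$ for all $v$. $\Gamma^+(v,i)$ is the head of the $i$-th outgoing edge of $v$ and $\Gamma^-(v,i)$ the tail of the $i$-th incoming edge of $v$, w.r.t. arbitrary fixed orderings. Algorithm \textsc{Space-Efficient-Hierholzer}: initialise integer arrays $\texttt{next}[1..n]$, $\texttt{visited}[1..n]$, $\texttt{skipped}[1..n]$, $B[1..n]$ to all zeros and $c\gets 0$. Pick an arbitrary $v_0\in[n]$, set $u\gets v_0$ and $\texttt{visited}[u]\gets 1$. While $c<m$: set $\texttt{next}[u]\gets\texttt{next}[u]+1$ and $i\gets\texttt{next}[u]$. If $i\le d^-(u)$: let $v\gets\Gamma^-(u,i)$; if $\texttt{visited}[v]=0$ then (if $v\ne v_0$ set $B[v]\gets u$) and set $\texttt{visited}[v]\gets 1$; then set $u\gets v$. Otherwise: set $i\gets \texttt{next}[u]-d^-(u)$; if $\Gamma^+(u,i)=B[u]$ and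 $\texttt{skipped}[u]=0$, then set $\texttt{skipped}[u]\gets 1$, $\texttt{next}[u]\gets\texttt{next}[u]+1$, $i\gets i+1$ (the test is taken to be false if $i>d^+(u)$). Then if $i>d^+(u)$ let $v\gets B[u]$, else $v\gets \Gamma^+(u,i)$; write the edge $uv$ to the output, set $c\gets c+1$ and $u\gets v$. -}

module Defs where

open import Data.Nat using (ℕ; zero; suc; _+_; _*_; _∸_; _≤_; _<_; _≤ᵇ_; _<ᵇ_)
open import Data.Nat.Properties using (_<?_)
open import Data.Fin using (Fin; _≟_)
open import Data.Bool using (Bool; true; false; if_then_else_; _∧_; not)
open import Data.Maybe using (Maybe; just; nothing; _>>=_)
open import Data.List using (List; []; _∷_; length; filter; map; _∷ʳ_)
open import Data.Nat.ListAction using (sum)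
open import Data.List.Membership.Propositional using (_∈_)
open import Data.List.Relation.Unary.Any using ()
open import Data.Product using (_×_; _,_)
open import Relation.Nullary using (yes; no; does)
open import Relation.Binary.PropositionalEquality using (_≡_)

-- A directed multigraph on vertex set Fin n, *given with fixed orderings*
-- of the outgoing and incoming edges at each vertex:
--   outN v = [Γ⁺(v,1), ..., Γ⁺(v,d⁺(v))]   (heads of the out-edges of v, in order)
--   inN  v = [Γ⁻(v,1), ..., Γ⁻(v,d⁻(v))]   (tails of the in-edges of v, in order)
-- Consistency: both lists describe the same multiset of edges, i.e. the
-- number of u→v edges seen from u equals the number seen from v.

count : ∀ {n} → Fin n → List (Fin n) → ℕ
count v l = length (filter (_≟ v) l)

record Graph (n : ℕ) : Set where
  field
    outN : Fin n → List (Fin n)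
    inN  : Fin n → List (Fin n)
    consistent : ∀ u v → count v (outN u) ≡ count u (inN v)

open Graph public

d⁺ d⁻ : ∀ {n} → Graph n → Fin n → ℕ
d⁺ G v = length (outN G v)
d⁻ G v = length (inN G v)

allV : ∀ n → List (Fin n)
allV zero = []
allV (suc n) = Fin.zero ∷ map Fin.suc (allV n)

edges : ∀ {n} → Graph n → ℕ
edges {n} G = sum (map (d⁺ G) (allV n))

data Reach {n} (G : Graph n) : Fin n → Fin n → Set where
  here  : ∀ {u} → Reach G u u
  there : ∀ {u w v} → w ∈ outN G u → Reach G w v → Reach G u v

StronglyConnected : ∀ {n} → Graph n → Set
StronglyConnected {n} G = ∀ (u v : Fin n) → Reach G u v

Eulerian : ∀ {n} → Graph n → Set
Eulerian {n} G = StronglyConnected G × (∀ (v : Fin n) → d⁺ G v ≡ d⁻ G v)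

-- 1-based list access: Γ(v,i) = nth (list v) i
nth : ∀ {A : Set} → List A → ℕ → Maybe A
nth []       _             = nothing
nth (x ∷ xs) zero          = nothing
nth (x ∷ xs) (suc zero)    = just x
nth (x ∷ xs) (suc (suc i)) = nth xs (suc i)

-- Space-Efficient-Hierholzer.
-- Arrays: next : ℕ, visited/skipped : Bool (0/1), B : Maybe (Fin n)
-- (nothing = the initial value 0, which is not a vertex of [n]).

update : ∀ {n} {A : Set} → (Fin n → A) → Fin n → A → Fin n → A
update f x a y with does (y ≟ x)
... | true  = a
... | false = f y

record State (n : ℕ) : Set where
  field
    cur     : Fin n
    next    : Fin n → ℕ
    visited : Fin n → Bool
    skipped : Fin n → Bool
    B       : Fin n → Maybe (Fin n)
    c       : ℕ
    output  : List (Fin n × Fin n)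

open State public

init : ∀ {n} → Fin n → State n
init v0 = record
  { cur = v0 ; next = λ _ → 0
  ; visited = update (λ _ → false) v0 true
  ; skipped = λ _ → false ; B = λ _ → nothing ; c = 0 ; output = [] }

eqM : ∀ {n} → Maybe (Fin n) → Maybe (Fin n) → Bool
eqM (just x) (just y) = does (x ≟ y)
eqM _        _        = false

-- One iteration of the while-loop body.  `nothing` means the algorithm
-- would access something undefined (e.g. use B[u] = 0 as a vertex).
step : ∀ {n} → Graph n → Fin n → State n → Maybe (State n)
step G v0 s =
  let u  = cur s
      nx = next s u + 1
      s1 = record s { next = update (next s) u nx }
  in if nx ≤ᵇ d⁻ G u
     then (nth (inN G u) nx >>= λ v →
            just (if visited s v
                  then record s1 { cur = v }
                  else record s1
                    { cur = v
                    ; visited = update (visited s) v true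
                    ; B = if does (v ≟ v0) then B s else update (B s) v (just u) }))
     else
       (let i    = nx ∸ d⁻ G u
            test = (i ≤ᵇ d⁺ G u) ∧ eqM (nth (outN G u) i) (B s u) ∧ not (skipped s u)
            s2   = if test
                   then record s1 { skipped = update (skipped s) u true
                                  ; next = update (next s) u (nx + 1) }
                   else s1
            i'   = if test then i + 1 else i
            mv   = if d⁺ G u <ᵇ i' then B s u else nth (outN G u) i'
        in mv >>= λ v →
           just (record s2 { cur = v ; c = c s + 1
                           ; output = output s ∷ʳ (u , v) }))

run : ∀ {n} → Graph n → Fin n → ℕ → State n → Maybe (State n)
run G v0 zero    s = just s
run G v0 (suc k) s with does (c s <? edges G)
... | true  = step G v0 s >>= run G v0 k
... | false = just s

{-# OPTIONS --safe #-}
-- Each iteration of the loop either scans a new in-edge of the current vertex or outputs an edge,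
-- so the potential Σₓ min(next[x], d⁻(x)) + c grows by one per iteration; as it is at most m + c,
-- 2m iterations suffice, provided no iteration gets stuck.  The scanned in-edges, read backwards,
-- form a trail from some vertex trailEnd to the current vertex, and the output is a trail from v0
-- to trailEnd.  Since d⁺ = d⁻, the out-phase at u happens only when u = trailEnd, and then u still
-- has an unused out-edge unless u = v0.  The skip mechanism makes the edge to the parent B[u] the
-- last one u emits; so if v0 runs out of edges, induction down the tree B shows that every visited
-- vertex has used all its edges, strong connectivity makes every vertex visited, and all m edges
-- have been output.
module Submission where

open import Defs
open import Data.Nat using (ℕ; zero; suc; _+_; _*_; _∸_; _≤_; _<_; _≤ᵇ_; _<ᵇ_; z≤n; s≤s; s≤s⁻¹)
open import Data.Nat.Properties hiding (_≟_)
open import Data.Nat.Solver using (module +-*-Solver)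
open import Data.Fin using (Fin; _≟_)
import Data.Fin as Fin
open import Data.Bool using (Bool; true; false; if_then_else_; _∧_; _∨_; not; T)
open import Data.Bool.Properties using (T-≡; ∧-zeroʳ; ∨-zeroʳ; ∨-identityʳ)
open import Function.Bundles using (Equivalence)
open import Relation.Nullary.Reflects using (ofʸ)
open import Data.Maybe using (Maybe; just; nothing; _>>=_)
open import Data.Maybe.Properties using (just-injective)
open import Function.Base using (_∘_)
open import Data.List using (List; []; _∷_; length; filter; map; _∷ʳ_; take; _++_)
open import Data.List.Properties
  using (length-map; take-all; length-++; length-take; filter-++; map-cong; map-∘; ++-assoc; length-++-≤ˡ)
open import Data.Nat.ListAction using (sum)
open import Data.List.Membership.Propositional using (_∈_)
open import Data.List.Membership.Propositional.Properties using (∈-map⁺; ∈-++⁻)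
open import Data.List.Relation.Unary.Any using (here; there)
open import Data.Product using (∃; ∃₂; _×_; _,_; proj₁; proj₂)
open import Data.Sum using (_⊎_; inj₁; inj₂; map₂)
open import Data.Empty using (⊥-elim)
open import Relation.Nullary using (Dec; yes; no; does; ¬_)
open import Relation.Binary.Definitions using (tri<; tri≈; tri>)
open import Relation.Binary.PropositionalEquality
open import Algebra.Properties.CommutativeSemigroup +-commutativeSemigroup using (interchange; xy∙z≈xz∙y)

true≢false : true ≢ false
true≢false ()

bit : Bool → ℕ
bit true = 1
bit false = 0

≤ᵇ-true : ∀ {m n} → m ≤ n → (m ≤ᵇ n) ≡ true
≤ᵇ-true {m} {n} m≤n = Equivalence.to T-≡ (≤⇒≤ᵇ m≤n)

<ᵇ-true : ∀ {m n} → m < n → (m <ᵇ n) ≡ true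
<ᵇ-true m<n = Equivalence.to T-≡ (<⇒<ᵇ m<n)

<ᵇ-false : ∀ {m n} → n ≤ m → (m <ᵇ n) ≡ false
<ᵇ-false {m} {n} n≤m with m <ᵇ n | <ᵇ-reflects-< m n
... | false | _ = refl
... | true | ofʸ m<n = ⊥-elim (<⇒≱ m<n n≤m)

≤ᵇ-false : ∀ {m n} → n < m → (m ≤ᵇ n) ≡ false
≤ᵇ-false {m} {n} n<m with m ≤ᵇ n | ≤ᵇ-reflects-≤ m n
... | false | _ = refl
... | true | ofʸ m≤n = ⊥-elim (<⇒≱ n<m m≤n)

<ᵇ-true⁻¹ : ∀ {m n} → (m <ᵇ n) ≡ true → m < n
<ᵇ-true⁻¹ {m} {n} eq = <ᵇ⇒< m n (Equivalence.from T-≡ eq)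

module _ {n : ℕ} where

  δ : Fin n → Fin n → ℕ
  δ x y = if does (x ≟ y) then 1 else 0

  δ-refl : ∀ x → δ x x ≡ 1
  δ-refl x with x ≟ x
  ... | yes _ = refl
  ... | no x≢x = ⊥-elim (x≢x refl)

  δ-≢ : ∀ {x y} → x ≢ y → δ x y ≡ 0
  δ-≢ {x} {y} x≢y with x ≟ y
  ... | yes x≡y = ⊥-elim (x≢y x≡y)
  ... | no _ = refl

  δ≤1 : ∀ x y → δ x y ≤ 1
  δ≤1 x y with does (x ≟ y)
  ... | true = ≤-refl
  ... | false = z≤n

  count-∷ : ∀ (v x : Fin n) l → count v (x ∷ l) ≡ δ x v + count v l
  count-∷ v x l with x ≟ v
  ... | yes _ = refl
  ... | no _ = refl

  count-++ : ∀ (v : Fin n) xs ys → count v (xs ++ ys) ≡ count v xs + count v ys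
  count-++ v xs ys = trans (cong length (filter-++ (_≟ v) xs ys)) (length-++ (filter (_≟ v) xs))

  count-∷ʳ : ∀ (v : Fin n) xs y → count v (xs ∷ʳ y) ≡ count v xs + δ y v
  count-∷ʳ v xs y = trans (count-++ v xs (y ∷ [])) (cong (count v xs +_) (trans (count-∷ v y []) (+-identityʳ (δ y v))))

  count≤length : ∀ (v : Fin n) l → count v l ≤ length l
  count≤length v [] = z≤n
  count≤length v (x ∷ l) rewrite count-∷ v x l = +-mono-≤ (δ≤1 x v) (count≤length v l)

  count-take≤ : ∀ (v : Fin n) k l → count v (take k l) ≤ count v l
  count-take≤ v zero l = z≤n
  count-take≤ v (suc k) [] = z≤n
  count-take≤ v (suc k) (x ∷ l) rewrite count-∷ v x (take k l) | count-∷ v x l =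
    +-monoʳ-≤ (δ x v) (count-take≤ v k l)

  ∈⇒count-pos : ∀ {v : Fin n} {l} → v ∈ l → 0 < count v l
  ∈⇒count-pos {v} {x ∷ l} (here refl) rewrite count-∷ v v l | δ-refl v = s≤s z≤n
  ∈⇒count-pos {v} {x ∷ l} (there v∈l) rewrite count-∷ v x l = ≤-trans (∈⇒count-pos v∈l) (m≤n+m _ (δ x v))

  count-pos⇒∈ : ∀ {v : Fin n} l → 0 < count v l → v ∈ l
  count-pos⇒∈ {v} (x ∷ l) pos with x ≟ v
  ... | yes refl = here refl
  ... | no _ = there (count-pos⇒∈ l pos)

module _ {A : Set} where

  sum-map-cong : ∀ (xs : List A) {f g : A → ℕ} → (∀ x → f x ≡ g x) → sum (map f xs) ≡ sum (map g xs)
  sum-map-cong xs f≗g = cong sum (map-cong f≗g xs)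

  sum-map-mono : ∀ (xs : List A) {f g : A → ℕ} → (∀ x → f x ≤ g x) → sum (map f xs) ≤ sum (map g xs)
  sum-map-mono [] f≤g = z≤n
  sum-map-mono (x ∷ xs) f≤g = +-mono-≤ (f≤g x) (sum-map-mono xs f≤g)

  sum-map-+ : ∀ (xs : List A) (f g : A → ℕ) →
              sum (map (λ x → f x + g x) xs) ≡ sum (map f xs) + sum (map g xs)
  sum-map-+ [] f g = refl
  sum-map-+ (x ∷ xs) f g rewrite sum-map-+ xs f g = interchange (f x) (g x) _ _

  sum-map-0 : ∀ (xs : List A) → sum (map (λ _ → 0) xs) ≡ 0
  sum-map-0 [] = refl
  sum-map-0 (x ∷ xs) = sum-map-0 xs

  length≤sum-map : ∀ (xs : List A) {f : A → ℕ} → (∀ x → 1 ≤ f x) → length xs ≤ sum (map f xs)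
  length≤sum-map [] pos = z≤n
  length≤sum-map (x ∷ xs) pos = +-mono-≤ (pos x) (length≤sum-map xs pos)

  sum-map-≤-tight : ∀ (xs : List A) {f g : A → ℕ} → (∀ x → f x ≤ g x) →
                    sum (map g xs) ≤ sum (map f xs) → ∀ {x} → x ∈ xs → f x ≡ g x
  sum-map-≤-tight (y ∷ xs) {f} {g} f≤g sg≤sf (here refl) =
    ≤-antisym (f≤g y) (+-cancelʳ-≤ (sum (map f xs)) (g y) (f y)
      (≤-trans (+-monoʳ-≤ (g y) (sum-map-mono xs f≤g)) sg≤sf))
  sum-map-≤-tight (y ∷ xs) {f} {g} f≤g sg≤sf (there x∈xs) =
    sum-map-≤-tight xs f≤g (+-cancelˡ-≤ (f y) (sum (map g xs)) (sum (map f xs))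
      (≤-trans (+-monoˡ-≤ (sum (map g xs)) (f≤g y)) sg≤sf)) x∈xs

Σᵥ : ∀ {n} → (Fin n → ℕ) → ℕ
Σᵥ {n} f = sum (map f (allV n))

allV-complete : ∀ {n} (x : Fin n) → x ∈ allV n
allV-complete Fin.zero = here refl
allV-complete (Fin.suc x) = there (∈-map⁺ Fin.suc (allV-complete x))

length-allV : ∀ n → length (allV n) ≡ n
length-allV zero = refl
length-allV (suc n) = cong suc (trans (length-map Fin.suc (allV n)) (length-allV n))

Σᵥ-suc : ∀ {n} (f : Fin (suc n) → ℕ) → Σᵥ f ≡ f Fin.zero + Σᵥ (λ x → f (Fin.suc x))
Σᵥ-suc {n} f = cong (λ xs → f Fin.zero + sum xs) (sym (map-∘ (allV n)))

Σᵥ-update : ∀ {n} (u : Fin n) (k : ℕ) {f g : Fin n → ℕ} →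
            (∀ x → x ≢ u → g x ≡ f x) → g u ≡ f u + k → Σᵥ g ≡ Σᵥ f + k
Σᵥ-update {suc n} Fin.zero k {f} {g} others gu = begin
  Σᵥ g                                       ≡⟨ Σᵥ-suc g ⟩
  g Fin.zero + Σᵥ (λ x → g (Fin.suc x))      ≡⟨ cong₂ _+_ gu (sum-map-cong (allV n) (λ x → others (Fin.suc x) (λ ()))) ⟩
  f Fin.zero + k + Σᵥ (λ x → f (Fin.suc x))  ≡⟨ xy∙z≈xz∙y (f Fin.zero) k _ ⟩
  f Fin.zero + Σᵥ (λ x → f (Fin.suc x)) + k  ≡⟨ cong (_+ k) (Σᵥ-suc f) ⟨
  Σᵥ f + k                                   ∎
  where open ≡-Reasoning
Σᵥ-update {suc n} (Fin.suc u) k {f} {g} others gu = begin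
  Σᵥ g                                         ≡⟨ Σᵥ-suc g ⟩
  g Fin.zero + Σᵥ (λ x → g (Fin.suc x))        ≡⟨ cong₂ _+_ (others Fin.zero (λ ()))
                                                    (Σᵥ-update u k (λ x x≢u → others (Fin.suc x) (λ { refl → x≢u refl })) gu) ⟩
  f Fin.zero + (Σᵥ (λ x → f (Fin.suc x)) + k)  ≡⟨ +-assoc (f Fin.zero) _ k ⟨
  f Fin.zero + Σᵥ (λ x → f (Fin.suc x)) + k    ≡⟨ cong (_+ k) (Σᵥ-suc f) ⟨
  Σᵥ f + k                                     ∎
  where open ≡-Reasoning

Σᵥ-δ : ∀ {n} (u : Fin n) → Σᵥ (δ u) ≡ 1
Σᵥ-δ {n} u = trans (Σᵥ-update u 1 (λ x x≢u → δ-≢ (x≢u ∘ sym)) (δ-refl u))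
                   (cong (_+ 1) (sum-map-0 (allV n)))

Σᵥ-count : ∀ {n} (l : List (Fin n)) → Σᵥ (λ x → count x l) ≡ length l
Σᵥ-count {n} [] = sum-map-0 (allV n)
Σᵥ-count {n} (y ∷ l) = begin
  Σᵥ (λ x → count x (y ∷ l))         ≡⟨ sum-map-cong (allV n) (λ x → count-∷ x y l) ⟩
  Σᵥ (λ x → δ y x + count x l)       ≡⟨ sum-map-+ (allV n) (δ y) (λ x → count x l) ⟩
  Σᵥ (δ y) + Σᵥ (λ x → count x l)    ≡⟨ cong₂ _+_ (Σᵥ-δ y) (Σᵥ-count l) ⟩
  suc (length l)                     ∎
  where open ≡-Reasoning

module _ {A : Set} where

  nth-++ˡ : ∀ (xs ys : List A) {i} → i < length xs → nth (xs ++ ys) (suc i) ≡ nth xs (suc i)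
  nth-++ˡ (x ∷ xs) ys {zero} _ = refl
  nth-++ˡ (x ∷ xs) ys {suc i} (s≤s i<) = nth-++ˡ xs ys i<

  nth-++ʳ : ∀ (xs ys : List A) i → nth (xs ++ ys) (suc (length xs + i)) ≡ nth ys (suc i)
  nth-++ʳ [] ys i = refl
  nth-++ʳ (x ∷ xs) ys i = nth-++ʳ xs ys i

  nth-∈ : ∀ (xs : List A) i {y} → nth xs (suc i) ≡ just y → y ∈ xs
  nth-∈ (x ∷ xs) zero refl = here refl
  nth-∈ (x ∷ xs) (suc i) eq = there (nth-∈ xs i eq)

  nth-take : ∀ (xs : List A) i → i < length xs →
             ∃ λ y → nth xs (suc i) ≡ just y × take (suc i) xs ≡ take i xs ∷ʳ y
  nth-take (x ∷ xs) zero _ = x , refl , refl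
  nth-take (x ∷ xs) (suc i) (s≤s i<) with nth-take xs i i<
  ... | y , eq , take≡ = y , eq , cong (x ∷_) take≡

  take-suc-nth : ∀ (xs : List A) k {y} → nth xs (suc k) ≡ just y → take (suc k) xs ≡ take k xs ∷ʳ y
  take-suc-nth (x ∷ xs) zero refl = refl
  take-suc-nth (x ∷ xs) (suc k) eq = cong (x ∷_) (take-suc-nth xs k eq)

  nth-∷ʳ-last : ∀ (xs : List A) y → nth (xs ∷ʳ y) (suc (length xs)) ≡ just y
  nth-∷ʳ-last xs y = trans (cong (λ i → nth (xs ∷ʳ y) (suc i)) (sym (+-identityʳ (length xs)))) (nth-++ʳ xs (y ∷ []) 0)

module _ {n : ℕ} where

  firstIndex : Fin n → List (Fin n) → ℕ
  firstIndex p [] = 0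
  firstIndex p (x ∷ l) = if does (x ≟ p) then 0 else suc (firstIndex p l)

  removeFirst : Fin n → List (Fin n) → List (Fin n)
  removeFirst p [] = []
  removeFirst p (x ∷ l) = if does (x ≟ p) then l else x ∷ removeFirst p l

  split-first : ∀ {p : Fin n} {l} → p ∈ l →
    ∃₂ λ pre post → l ≡ pre ++ p ∷ post × ¬ p ∈ pre ×
                    firstIndex p l ≡ length pre × removeFirst p l ≡ pre ++ post
  split-first {p} {x ∷ l} p∈l with x ≟ p | p∈l
  ... | yes refl | _ = [] , l , refl , (λ ()) , refl , refl
  ... | no x≢p | here p≡x = ⊥-elim (x≢p (sym p≡x))
  ... | no x≢p | there p∈l′ with split-first p∈l′
  ... | pre , post , refl , p∉pre , fi , rf =
    x ∷ pre , post , refl , (λ { (here p≡x) → x≢p (sym p≡x) ; (there p∈pre) → p∉pre p∈pre }) ,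
    cong suc fi , cong (x ∷_) rf

module _ {n : ℕ} where

  -- The order in which a vertex emits its out-edges: the first edge to its parent is skipped and
  -- emitted last.
  exitOrder : Maybe (Fin n) → List (Fin n) → List (Fin n)
  exitOrder nothing l = l
  exitOrder (just p) l = removeFirst p l ∷ʳ p

  skipFlag : Maybe (Fin n) → List (Fin n) → ℕ → Bool
  skipFlag nothing l f = false
  skipFlag (just p) l f = firstIndex p l <ᵇ f

  skipFlag-0 : ∀ mb l → skipFlag mb l 0 ≡ false
  skipFlag-0 nothing l = refl
  skipFlag-0 (just p) l = refl

  -- The out-phase of Defs.step at a vertex with out-list l, parent mb and skip flag sk, where i is
  -- the 1-based index into l.
  skipTest : List (Fin n) → Maybe (Fin n) → Bool → ℕ → Bool
  skipTest l mb sk i = (i ≤ᵇ length l) ∧ eqM (nth l i) mb ∧ not sk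

  exitIndex : List (Fin n) → Maybe (Fin n) → Bool → ℕ → ℕ
  exitIndex l mb sk i = if skipTest l mb sk i then i + 1 else i

  exitPick : List (Fin n) → Maybe (Fin n) → Bool → ℕ → Maybe (Fin n)
  exitPick l mb sk i = if length l <ᵇ exitIndex l mb sk i then mb else nth l (exitIndex l mb sk i)

  record ExitStep (l : List (Fin n)) (mb : Maybe (Fin n)) (σ : List (Fin n)) (flag : ℕ → Bool)
                  (sk : Bool) (f : ℕ) : Set where
    field
      pick≡  : exitPick l mb sk (suc f) ≡ nth σ (suc (f ∸ bit sk))
      flag≡  : (sk ∨ skipTest l mb sk (suc f)) ≡ flag (exitIndex l mb sk (suc f))
      index≡ : exitIndex l mb sk (suc f) ∸ bit (sk ∨ skipTest l mb sk (suc f)) ≡ suc (f ∸ bit sk)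

  private
    exitIndex-keep : ∀ l mb sk i → skipTest l mb sk i ≡ false → exitIndex l mb sk i ≡ i
    exitIndex-keep l mb sk i test≡ rewrite test≡ = refl

    exitIndex-skip : ∀ l mb sk i → skipTest l mb sk i ≡ true → exitIndex l mb sk i ≡ i + 1
    exitIndex-skip l mb sk i test≡ rewrite test≡ = refl

    pick-within : ∀ l mb sk i {i′} → exitIndex l mb sk i ≡ i′ → i′ ≤ length l →
                  exitPick l mb sk i ≡ nth l i′
    pick-within l mb sk i idx≡ i′≤ rewrite idx≡ | <ᵇ-false i′≤ = refl

    pick-beyond : ∀ l mb sk i {i′} → exitIndex l mb sk i ≡ i′ → length l < i′ →
                  exitPick l mb sk i ≡ mb
    pick-beyond l mb sk i idx≡ l<i′ rewrite idx≡ | <ᵇ-true l<i′ = refl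

  exitStep-root : ∀ l f → f < length l → ExitStep l nothing l (λ _ → false) false f
  exitStep-root l f f<l = record
    { pick≡ = pick-within l nothing false (suc f) idx≡ f<l
    ; flag≡ = test≡
    ; index≡ = cong₂ _∸_ idx≡ (cong bit test≡) }
    where
    eqM-nothing : ∀ (m : Maybe (Fin n)) → eqM m nothing ≡ false
    eqM-nothing (just _) = refl
    eqM-nothing nothing = refl
    test≡ : skipTest l nothing false (suc f) ≡ false
    test≡ rewrite eqM-nothing (nth l (suc f)) = ∧-zeroʳ _
    idx≡ : exitIndex l nothing false (suc f) ≡ suc f
    idx≡ = exitIndex-keep l nothing false (suc f) test≡

  module _ {p : Fin n} (pre post : List (Fin n)) (p∉pre : ¬ p ∈ pre) where
    private
      l σ : List (Fin n)
      l = pre ++ p ∷ post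
      σ = (pre ++ post) ∷ʳ p
      j : ℕ
      j = length pre

      σ≡ : σ ≡ pre ++ (post ∷ʳ p)
      σ≡ = ++-assoc pre post (p ∷ [])

      length-l : length l ≡ j + suc (length post)
      length-l = length-++ pre

      nth-σ-after : ∀ d → nth σ (suc (j + d)) ≡ nth (post ∷ʳ p) (suc d)
      nth-σ-after d = trans (cong (λ xs → nth xs (suc (j + d))) σ≡) (nth-++ʳ pre (post ∷ʳ p) d)

      nth-l-after : ∀ d → nth l (suc (suc (j + d))) ≡ nth post (suc d)
      nth-l-after d = trans (cong (λ i → nth l (suc i)) (sym (+-suc j d))) (nth-++ʳ pre (p ∷ post) (suc d))

    exitStep-before : ∀ f → f < j → ExitStep l (just p) σ (j <ᵇ_) false f
    exitStep-before f f<j = record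
      { pick≡ = trans (pick-within l (just p) false (suc f) idx≡ (≤-trans f<j (length-++-≤ˡ pre)))
                  (trans (nth-++ˡ pre (p ∷ post) f<j)
                  (trans (sym (nth-++ˡ pre (post ∷ʳ p) f<j)) (cong (λ xs → nth xs (suc f)) (sym σ≡))))
      ; flag≡ = trans test≡ (sym (trans (cong (j <ᵇ_) idx≡) (<ᵇ-false f<j)))
      ; index≡ = cong₂ _∸_ idx≡ (cong bit test≡) }
      where
      y : Fin n
      y = proj₁ (nth-take pre f f<j)
      nth-pre≡ : nth pre (suc f) ≡ just y
      nth-pre≡ = proj₁ (proj₂ (nth-take pre f f<j))
      y≢p : does (y ≟ p) ≡ false
      y≢p with y ≟ p
      ... | yes refl = ⊥-elim (p∉pre (nth-∈ pre f nth-pre≡))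
      ... | no _ = refl
      test≡ : skipTest l (just p) false (suc f) ≡ false
      test≡ rewrite nth-++ˡ pre (p ∷ post) f<j | nth-pre≡ | y≢p = ∧-zeroʳ _
      idx≡ : exitIndex l (just p) false (suc f) ≡ suc f
      idx≡ = exitIndex-keep l (just p) false (suc f) test≡

    exitStep-at : ExitStep l (just p) σ (j <ᵇ_) false j
    exitStep-at = record
      { pick≡ = trans (pick-at post refl) (sym nth-σ-at)
      ; flag≡ = trans test≡ (sym (trans (cong (j <ᵇ_) idx≡) (<ᵇ-true (s≤s (m≤m+n j 1)))))
      ; index≡ = trans (cong₂ _∸_ idx≡ (cong bit test≡)) (+-comm j 1) }
      where
      j+0≡j : j + 0 ≡ j
      j+0≡j = +-identityʳ j
      nth-l-at : nth l (suc j) ≡ just p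
      nth-l-at = subst (λ i → nth l (suc i) ≡ just p) j+0≡j (nth-++ʳ pre (p ∷ post) 0)
      nth-σ-at : nth σ (suc j) ≡ nth (post ∷ʳ p) 1
      nth-σ-at = subst (λ i → nth σ (suc i) ≡ nth (post ∷ʳ p) 1) j+0≡j (nth-σ-after 0)
      p≟p : does (p ≟ p) ≡ true
      p≟p with p ≟ p
      ... | yes _ = refl
      ... | no p≢p = ⊥-elim (p≢p refl)
      test≡ : skipTest l (just p) false (suc j) ≡ true
      test≡ rewrite nth-l-at | p≟p | ≤ᵇ-true (subst (suc j ≤_) (sym length-l) (m<m+n j (s≤s z≤n))) = refl
      idx≡ : exitIndex l (just p) false (suc j) ≡ suc j + 1
      idx≡ = exitIndex-skip l (just p) false (suc j) test≡
      pick-at : ∀ rest → rest ≡ post → exitPick l (just p) false (suc j) ≡ nth (rest ∷ʳ p) 1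
      pick-at [] refl = pick-beyond l (just p) false (suc j) idx≡ (s≤s (≤-reflexive length-l))
      pick-at (q ∷ rest) refl = trans (pick-within l (just p) false (suc j) idx≡ within)
                                      (trans (cong (λ i → nth l (suc i)) (+-suc j 0)) (nth-l-after 0))
        where
        within : suc j + 1 ≤ length l
        within = subst (suc j + 1 ≤_) (sym length-l)
                   (subst (_≤ j + suc (suc (length rest))) (+-suc j 1) (+-monoʳ-≤ j (s≤s (s≤s z≤n))))

    exitStep-after : ∀ d → j + d < length l → ExitStep l (just p) σ (j <ᵇ_) true (suc (j + d))
    exitStep-after d bound = record
      { pick≡ = pick-after (m≤n⇒m<n∨m≡n d≤post)
      ; flag≡ = sym (trans (cong (j <ᵇ_) idx≡) (<ᵇ-true (s≤s (≤-trans (m≤m+n j d) (n≤1+n _)))))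
      ; index≡ = cong (_∸ 1) idx≡ }
      where
      test≡ : skipTest l (just p) true (suc (suc (j + d))) ≡ false
      test≡ = trans (cong ((suc (suc (j + d)) ≤ᵇ length l) ∧_) (∧-zeroʳ (eqM (nth l (suc (suc (j + d)))) (just p))))
                    (∧-zeroʳ _)
      idx≡ : exitIndex l (just p) true (suc (suc (j + d))) ≡ suc (suc (j + d))
      idx≡ = exitIndex-keep l (just p) true (suc (suc (j + d))) test≡
      suc-j+d : suc (j + d) ≡ j + suc d
      suc-j+d = sym (+-suc j d)
      d≤post : d ≤ length post
      d≤post = s≤s⁻¹ (+-cancelˡ-≤ j _ _ (subst (_≤ j + suc (length post)) suc-j+d (subst (suc (j + d) ≤_) length-l bound)))
      pick-after : d < length post ⊎ d ≡ length post →
                   exitPick l (just p) true (suc (suc (j + d))) ≡ nth σ (suc (j + d))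
      pick-after (inj₁ d<post) =
        trans (pick-within l (just p) true (suc (suc (j + d))) idx≡ within)
              (trans (nth-l-after d) (trans (sym (nth-++ˡ post (p ∷ []) d<post)) (sym (nth-σ-after d))))
        where
        within : suc (suc (j + d)) ≤ length l
        within = subst (suc (suc (j + d)) ≤_) (sym length-l)
                   (subst (_≤ j + suc (length post)) (trans (+-suc j (suc d)) (cong suc (+-suc j d))) (+-monoʳ-≤ j (s≤s d<post)))
      pick-after (inj₂ refl) =
        trans (pick-beyond l (just p) true (suc (suc (j + d))) idx≡ (s≤s (≤-reflexive (trans length-l (sym suc-j+d)))))
              (sym (trans (nth-σ-after d) (nth-∷ʳ-last post p)))

    exitStep-split : ∀ sk f → sk ≡ (j <ᵇ f) → f ∸ bit sk < length l → ExitStep l (just p) σ (j <ᵇ_) sk f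
    exitStep-split sk f sk≡ bound with <-cmp f j
    ... | tri< f<j _ _ rewrite sk≡ | <ᵇ-false {j} (<⇒≤ f<j) = exitStep-before f f<j
    ... | tri≈ _ refl _ rewrite sk≡ | <ᵇ-false {j} (≤-refl {j}) = exitStep-at
    ... | tri> _ _ j<f with m≤n⇒∃[o]m+o≡n j<f
    ... | d , refl rewrite sk≡ | <ᵇ-true j<f = exitStep-after d bound

  ParentIn : Maybe (Fin n) → List (Fin n) → Set
  ParentIn mb l = ∀ {p} → mb ≡ just p → p ∈ l

  exitStep : ∀ l mb sk f → ParentIn mb l → sk ≡ skipFlag mb l f → f ∸ bit sk < length l →
             ExitStep l mb (exitOrder mb l) (skipFlag mb l) sk f
  exitStep l nothing sk f _ refl bound = exitStep-root l f bound
  exitStep l (just p) sk f p∈l sk≡ bound with split-first (p∈l refl)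
  ... | pre , post , refl , p∉pre , fi≡ , rf≡ =
    subst₂ (λ σ j → ExitStep l (just p) σ (j <ᵇ_) sk f) (cong (_∷ʳ p) (sym rf≡)) (sym fi≡)
      (exitStep-split pre post p∉pre sk f (trans sk≡ (cong (_<ᵇ f) fi≡)) bound)

  exitOrder-count : ∀ mb l b → ParentIn mb l → count b (exitOrder mb l) ≡ count b l
  exitOrder-count nothing l b _ = refl
  exitOrder-count (just p) l b p∈l with split-first (p∈l refl)
  ... | pre , post , refl , _ , _ , rf≡ = begin
    count b (removeFirst p l ∷ʳ p)        ≡⟨ cong (λ xs → count b (xs ∷ʳ p)) rf≡ ⟩
    count b ((pre ++ post) ∷ʳ p)          ≡⟨ count-∷ʳ b (pre ++ post) p ⟩
    count b (pre ++ post) + δ p b         ≡⟨ cong (_+ δ p b) (count-++ b pre post) ⟩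
    count b pre + count b post + δ p b    ≡⟨ +-assoc (count b pre) _ _ ⟩
    count b pre + (count b post + δ p b)  ≡⟨ cong (count b pre +_) (+-comm (count b post) (δ p b)) ⟩
    count b pre + (δ p b + count b post)  ≡⟨ cong (count b pre +_) (count-∷ b p post) ⟨
    count b pre + count b (p ∷ post)      ≡⟨ count-++ b pre (p ∷ post) ⟨
    count b l                             ∎
    where open ≡-Reasoning

  exitOrder-length : ∀ mb l → ParentIn mb l → length (exitOrder mb l) ≡ length l
  exitOrder-length mb l p∈l = begin
    length (exitOrder mb l)              ≡⟨ Σᵥ-count (exitOrder mb l) ⟨
    Σᵥ (λ b → count b (exitOrder mb l))  ≡⟨ sum-map-cong (allV n) (λ b → exitOrder-count mb l b p∈l) ⟩
    Σᵥ (λ b → count b l)                 ≡⟨ Σᵥ-count l ⟩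
    length l                             ∎
    where open ≡-Reasoning

  count-take-∷ʳ : ∀ (p : Fin n) xs k → k ≤ length xs → count p (take k (xs ∷ʳ p)) < count p (xs ∷ʳ p)
  count-take-∷ʳ p xs k k≤ = begin-strict
    count p (take k (xs ∷ʳ p))   ≡⟨ cong (count p) (take-++ˡ xs k≤) ⟩
    count p (take k xs)          ≤⟨ count-take≤ p k xs ⟩
    count p xs                   <⟨ m<m+n (count p xs) (subst (0 <_) (sym (δ-refl p)) (s≤s z≤n)) ⟩
    count p xs + δ p p           ≡⟨ count-∷ʳ p xs p ⟨
    count p (xs ∷ʳ p)            ∎
    where
    open ≤-Reasoning
    take-++ˡ : ∀ (ys : List (Fin n)) {k zs} → k ≤ length ys → take k (ys ++ zs) ≡ take k ys
    take-++ˡ ys {zero} _ = refl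
    take-++ˡ (y ∷ ys) {suc k} (s≤s k≤) = cong (y ∷_) (take-++ˡ ys k≤)

  parent-last : ∀ p l k → count p (take k (exitOrder (just p) l)) ≡ count p (exitOrder (just p) l) →
                length (exitOrder (just p) l) ≤ k
  parent-last p l k full with length (exitOrder (just p) l) ≤? k
  ... | yes σ≤k = σ≤k
  ... | no σ≰k = ⊥-elim (<⇒≢ (count-take-∷ʳ p (removeFirst p l) k k≤) full)
    where
    k≤ : k ≤ length (removeFirst p l)
    k≤ = s≤s⁻¹ (subst (suc k ≤_) (trans (length-++ (removeFirst p l)) (+-comm _ 1)) (≰⇒> σ≰k))

module _ {n : ℕ} where

  update-same : ∀ {A : Set} (f : Fin n → A) x a → update f x a x ≡ a
  update-same f x a with x ≟ x
  ... | yes _ = refl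
  ... | no x≢x = ⊥-elim (x≢x refl)

  update-other : ∀ {A : Set} (f : Fin n → A) x a {y} → y ≢ x → update f x a y ≡ f y
  update-other f x a {y} y≢x with y ≟ x
  ... | yes y≡x = ⊥-elim (y≢x y≡x)
  ... | no _ = refl

  successors : Fin n → List (Fin n × Fin n) → List (Fin n)
  successors a [] = []
  successors a ((x , y) ∷ es) = if does (x ≟ a) then y ∷ successors a es else successors a es

  successors-∷ʳ-same : ∀ u y es → successors u (es ∷ʳ (u , y)) ≡ successors u es ∷ʳ y
  successors-∷ʳ-same u y [] with u ≟ u
  ... | yes _ = refl
  ... | no u≢u = ⊥-elim (u≢u refl)
  successors-∷ʳ-same u y ((x , z) ∷ es) with does (x ≟ u)
  ... | true = cong (z ∷_) (successors-∷ʳ-same u y es)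
  ... | false = successors-∷ʳ-same u y es

  successors-∷ʳ-other : ∀ {a u} y es → a ≢ u → successors a (es ∷ʳ (u , y)) ≡ successors a es
  successors-∷ʳ-other {a} {u} y [] a≢u with u ≟ a
  ... | yes u≡a = ⊥-elim (a≢u (sym u≡a))
  ... | no _ = refl
  successors-∷ʳ-other {a} y ((x , z) ∷ es) a≢u with does (x ≟ a)
  ... | true = cong (z ∷_) (successors-∷ʳ-other y es a≢u)
  ... | false = successors-∷ʳ-other y es a≢u

  Σᵥ-length-successors : ∀ es → Σᵥ (λ a → length (successors a es)) ≡ length es
  Σᵥ-length-successors [] = sum-map-0 (allV n)
  Σᵥ-length-successors ((x , y) ∷ es) = begin
    Σᵥ (λ a → length (successors a ((x , y) ∷ es)))  ≡⟨ sum-map-cong (allV n) length-∷ ⟩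
    Σᵥ (λ a → δ x a + length (successors a es))       ≡⟨ sum-map-+ (allV n) (δ x) _ ⟩
    Σᵥ (δ x) + Σᵥ (λ a → length (successors a es))    ≡⟨ cong₂ _+_ (Σᵥ-δ x) (Σᵥ-length-successors es) ⟩
    suc (length es)                                   ∎
    where
    open ≡-Reasoning
    length-∷ : ∀ a → length (successors a ((x , y) ∷ es)) ≡ δ x a + length (successors a es)
    length-∷ a with does (x ≟ a)
    ... | true = refl
    ... | false = refl

module _ {n : ℕ} (G : Graph n) where

  Σᵥ-count-outN : ∀ x → Σᵥ (λ a → count x (outN G a)) ≡ d⁻ G x
  Σᵥ-count-outN x = trans (sum-map-cong (allV n) (λ a → consistent G a x)) (Σᵥ-count (inN G x))

  Σᵥ-count-inN : ∀ x → Σᵥ (λ b → count x (inN G b)) ≡ d⁺ G x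
  Σᵥ-count-inN x = trans (sum-map-cong (allV n) (λ b → sym (consistent G x b))) (Σᵥ-count (outN G x))

  reach-other⇒out-edge : ∀ {x y} → x ≢ y → Reach G x y → 1 ≤ d⁺ G x
  reach-other⇒out-edge x≢y here = ⊥-elim (x≢y refl)
  reach-other⇒out-edge {x} _ (there w∈out _) = ≤-trans (∈⇒count-pos w∈out) (count≤length _ (outN G x))

vertices≤edges+1 : ∀ {n} (G : Graph n) → StronglyConnected G → n ≤ edges G + 1
vertices≤edges+1 {zero} G sc = z≤n
vertices≤edges+1 {suc zero} G sc = m≤n+m 1 (edges G)
vertices≤edges+1 {suc (suc k)} G sc = begin
  suc (suc k)                  ≡⟨ length-allV (suc (suc k)) ⟨
  length (allV (suc (suc k)))  ≤⟨ length≤sum-map (allV _) (λ x → reach-other⇒out-edge G (x≢other x) (sc x (other x))) ⟩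
  edges G                      ≤⟨ m≤m+n (edges G) 1 ⟩
  edges G + 1                  ∎
  where
  open ≤-Reasoning
  other : Fin (suc (suc k)) → Fin (suc (suc k))
  other Fin.zero = Fin.suc Fin.zero
  other (Fin.suc _) = Fin.zero
  x≢other : ∀ x → x ≢ other x
  x≢other Fin.zero ()
  x≢other (Fin.suc _) ()

module Algorithm {n : ℕ} (G : Graph n) (v0 : Fin n) where

  scanned : State n → Fin n → List (Fin n)
  scanned s b = take (next s b) (inN G b)

  fpos : State n → Fin n → ℕ
  fpos s a = next s a ∸ d⁻ G a

  -- A skip advances the pointer past the parent edge without emitting it.
  emitted : State n → Fin n → ℕ
  emitted s a = fpos s a ∸ bit (skipped s a)

  exits : State n → Fin n → List (Fin n)
  exits s a = exitOrder (B s a) (outN G a)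

  potential : State n → ℕ
  potential s = Σᵥ (λ x → length (scanned s x)) + c s

  -- backState and exitState are definitionally the two branches of Defs.step; the in-phase branch
  -- is split into discovering v and moving to it.
  discover : State n → Fin n → State n
  discover s v = record s { visited = update (visited s) v true
                          ; B = if does (v ≟ v0) then B s else update (B s) v (just (cur s)) }

  moveBack : State n → Fin n → State n
  moveBack s v = record s { next = update (next s) (cur s) (next s (cur s) + 1) ; cur = v }

  backState : State n → Fin n → State n
  backState s v = if visited s v then moveBack s v else moveBack (discover s v) v

  exitState : State n → Bool → Fin n → State n
  exitState s test v =
    let u = cur s
        nx = next s u + 1
        s1 = record s { next = update (next s) u nx }
        s2 = if test then record s1 { skipped = update (skipped s) u true ; next = update (next s) u (nx + 1) }
                     else s1
    in record s2 { cur = v ; c = c s + 1 ; output = output s ∷ʳ (u , v) }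

  step-back : ∀ s {v} → next s (cur s) < d⁻ G (cur s) → nth (inN G (cur s)) (suc (next s (cur s))) ≡ just v →
              step G v0 s ≡ just (backState s v)
  step-back s {v} N<d nth≡
    rewrite ≤ᵇ-true (subst (_≤ d⁻ G (cur s)) (+-comm 1 (next s (cur s))) N<d)
          | trans (cong (nth (inN G (cur s))) (+-comm (next s (cur s)) 1)) nth≡ = refl

  step-exit : ∀ s → (next s (cur s) + 1 ≤ᵇ d⁻ G (cur s)) ≡ false →
              let u = cur s ; l = outN G u ; i = next s u + 1 ∸ d⁻ G u in
              step G v0 s ≡ (exitPick l (B s u) (skipped s u) i >>= λ v →
                             just (exitState s (skipTest l (B s u) (skipped s u) i) v))
  step-exit s out-phase rewrite out-phase = refl

  record Invariant (s : State n) : Set where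
    field
      depth            : Fin n → ℕ
      trailEnd         : Fin n
      cur-visited      : visited s (cur s) ≡ true
      root-visited     : visited s v0 ≡ true
      unvisited-fresh  : ∀ x → visited s x ≡ false → next s x ≡ 0
      root-orphan      : B s v0 ≡ nothing
      has-parent       : ∀ x → visited s x ≡ true → x ≢ v0 → ∃ λ p → B s x ≡ just p
      parent-edge      : ∀ x {p} → B s x ≡ just p → p ∈ outN G x × visited s p ≡ true × depth p < depth x
      skip-flag        : ∀ x → skipped s x ≡ skipFlag (B s x) (outN G x) (fpos s x)
      scanned-visited  : ∀ x {y} → y ∈ scanned s x → visited s y ≡ true
      backward-balance : ∀ x → Σᵥ (λ b → count x (scanned s b)) + δ trailEnd x ≡ length (scanned s x) + δ (cur s) x
      forward-balance  : ∀ x → Σᵥ (λ a → count x (successors a (output s))) + δ v0 x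
                               ≡ length (successors x (output s)) + δ trailEnd x
      successors-exits : ∀ a → successors a (output s) ≡ take (emitted s a) (exits s a)
      c-length         : c s ≡ length (output s)

  init-invariant : Invariant (init v0)
  init-invariant = record
    { depth = λ _ → 0
    ; trailEnd = v0
    ; cur-visited = update-same _ v0 true
    ; root-visited = update-same _ v0 true
    ; unvisited-fresh = λ _ _ → refl
    ; root-orphan = refl
    ; has-parent = λ x x-vis x≢v0 → ⊥-elim (x≢v0 (init-visited x x-vis))
    ; parent-edge = λ _ ()
    ; skip-flag = λ x → refl
    ; scanned-visited = λ _ ()
    ; backward-balance = λ x → cong (_+ δ v0 x) (sum-map-0 (allV n))
    ; forward-balance = λ x → cong (_+ δ v0 x) (sum-map-0 (allV n))
    ; successors-exits = λ a → cong (λ k → take k (exits (init v0) a)) (sym (0∸n≡0 (d⁻ G a)))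
    ; c-length = refl }
    where
    init-visited : ∀ x → visited (init {n} v0) x ≡ true → x ≡ v0
    init-visited x vis with x ≟ v0
    ... | yes x≡v0 = x≡v0
    init-visited x () | no _

  unvisited-fpos : ∀ {s x} → Invariant s → visited s x ≡ false → fpos s x ≡ 0
  unvisited-fpos {s} {x} I unvis = trans (cong (_∸ d⁻ G x) (Invariant.unvisited-fresh I x unvis)) (0∸n≡0 (d⁻ G x))

  discover-invariant : ∀ {s v} → Invariant s → visited s v ≡ false → cur s ∈ outN G v → Invariant (discover s v)
  discover-invariant {s} {v} I v-new u∈out = record
    { depth = depth′
    ; trailEnd = trailEnd
    ; cur-visited = visited-mono cur-visited
    ; root-visited = visited-mono root-visited
    ; unvisited-fresh = λ x unvis → unvisited-fresh x (still-unvisited x unvis)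
    ; root-orphan = trans (B′ v0) (trans (update-other (B s) v _ (v≢v0 ∘ sym)) root-orphan)
    ; has-parent = has-parent′
    ; parent-edge = parent-edge′
    ; skip-flag = skip-flag′
    ; scanned-visited = λ x y∈ → visited-mono (scanned-visited x y∈)
    ; backward-balance = backward-balance
    ; forward-balance = forward-balance
    ; successors-exits = successors-exits′
    ; c-length = c-length }
    where
    open Invariant I
    s′ : State n
    s′ = discover s v
    u : Fin n
    u = cur s

    visited≢new : ∀ {x} → visited s x ≡ true → x ≢ v
    visited≢new x-vis refl = true≢false (trans (sym x-vis) v-new)

    v≢v0 : v ≢ v0
    v≢v0 v≡v0 = visited≢new root-visited (sym v≡v0)

    B′ : ∀ x → B s′ x ≡ update (B s) v (just u) x
    B′ x with v ≟ v0
    ... | yes v≡v0 = ⊥-elim (v≢v0 v≡v0)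
    ... | no _ = refl

    visited-mono : ∀ {x} → visited s x ≡ true → visited s′ x ≡ true
    visited-mono {x} x-vis = trans (update-other (visited s) v true (visited≢new x-vis)) x-vis

    still-unvisited : ∀ x → visited s′ x ≡ false → visited s x ≡ false
    still-unvisited x unvis = trans (sym (update-other (visited s) v true x≢v)) unvis
      where
      x≢v : x ≢ v
      x≢v refl = true≢false (trans (sym (update-same (visited s) v true)) unvis)

    depth′ : Fin n → ℕ
    depth′ = update depth v (suc (depth u))

    has-parent′ : ∀ x → visited s′ x ≡ true → x ≢ v0 → ∃ λ p → B s′ x ≡ just p
    has-parent′ x x-vis x≢v0 = case (x ≟ v)
      where
      case : Dec (x ≡ v) → ∃ λ p → B s′ x ≡ just p
      case (yes refl) = u , trans (B′ v) (update-same (B s) v (just u))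
      case (no x≢v) with has-parent x (trans (sym (update-other (visited s) v true x≢v)) x-vis) x≢v0
      ... | p , eq = p , trans (B′ x) (trans (update-other (B s) v _ x≢v) eq)

    parent-edge′ : ∀ x {p} → B s′ x ≡ just p → p ∈ outN G x × visited s′ p ≡ true × depth′ p < depth′ x
    parent-edge′ x {p} eq = case (x ≟ v)
      where
      case : Dec (x ≡ v) → p ∈ outN G x × visited s′ p ≡ true × depth′ p < depth′ x
      case (yes refl) with just-injective (trans (sym (update-same (B s) v (just u))) (trans (sym (B′ v)) eq))
      ... | refl = u∈out , visited-mono cur-visited ,
                   subst₂ _<_ (sym (update-other depth v _ (visited≢new cur-visited))) (sym (update-same depth v _)) ≤-refl
      case (no x≢v) with parent-edge x (trans (sym (update-other (B s) v _ x≢v)) (trans (sym (B′ x)) eq))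
      ... | p∈out , p-vis , p<x = p∈out , visited-mono p-vis ,
            subst₂ _<_ (sym (update-other depth v _ (visited≢new p-vis))) (sym (update-other depth v _ x≢v)) p<x

    skip-flag′ : ∀ x → skipped s′ x ≡ skipFlag (B s′ x) (outN G x) (fpos s′ x)
    skip-flag′ x = case (x ≟ v)
      where
      case : Dec (x ≡ v) → skipped s′ x ≡ skipFlag (B s′ x) (outN G x) (fpos s′ x)
      case (yes refl) = begin
        skipped s v                                  ≡⟨ skip-flag v ⟩
        skipFlag (B s v) (outN G v) (fpos s v)       ≡⟨ cong (skipFlag (B s v) (outN G v)) fpos-v ⟩
        skipFlag (B s v) (outN G v) 0                ≡⟨ skipFlag-0 (B s v) (outN G v) ⟩
        false                                        ≡⟨ skipFlag-0 (B s′ v) (outN G v) ⟨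
        skipFlag (B s′ v) (outN G v) 0               ≡⟨ cong (skipFlag (B s′ v) (outN G v)) fpos-v ⟨
        skipFlag (B s′ v) (outN G v) (fpos s v)      ∎
        where
        open ≡-Reasoning
        fpos-v : fpos s v ≡ 0
        fpos-v = unvisited-fpos I v-new
      case (no x≢v) = trans (skip-flag x) (cong (λ mb → skipFlag mb (outN G x) (fpos s x))
                                             (sym (trans (B′ x) (update-other (B s) v _ x≢v))))

    successors-exits′ : ∀ a → successors a (output s) ≡ take (emitted s a) (exitOrder (B s′ a) (outN G a))
    successors-exits′ a = case (a ≟ v)
      where
      case : Dec (a ≡ v) → successors a (output s) ≡ take (emitted s a) (exitOrder (B s′ a) (outN G a))
      case (yes refl) = begin
        successors v (output s)                       ≡⟨ successors-exits v ⟩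
        take (emitted s v) (exits s v)                ≡⟨ cong (λ k → take k (exits s v)) emitted-v ⟩
        []                                            ≡⟨ cong (λ k → take k (exitOrder (B s′ v) (outN G v))) emitted-v ⟨
        take (emitted s v) (exitOrder (B s′ v) (outN G v)) ∎
        where
        open ≡-Reasoning
        emitted-v : emitted s v ≡ 0
        emitted-v = trans (cong (_∸ bit (skipped s v)) (unvisited-fpos I v-new)) (0∸n≡0 (bit (skipped s v)))
      case (no a≢v) = trans (successors-exits a) (cong (λ mb → take (emitted s a) (exitOrder mb (outN G a)))
                                                    (sym (trans (B′ a) (update-other (B s) v _ a≢v))))

  moveBack-invariant : ∀ {s v} → Invariant s → visited s v ≡ true →
                       next s (cur s) < d⁻ G (cur s) →
                       scanned s (cur s) ∷ʳ v ≡ take (suc (next s (cur s))) (inN G (cur s)) →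
                       Invariant (moveBack s v) × potential (moveBack s v) ≡ suc (potential s)
  moveBack-invariant {s} {v} I v-vis N<d scan≡ = record
    { depth = depth
    ; trailEnd = trailEnd
    ; cur-visited = v-vis
    ; root-visited = root-visited
    ; unvisited-fresh = λ x unvis → trans (update-other (next s) u _ (unvisited≢cur unvis)) (unvisited-fresh x unvis)
    ; root-orphan = root-orphan
    ; has-parent = has-parent
    ; parent-edge = parent-edge
    ; skip-flag = λ x → trans (skip-flag x) (cong (skipFlag (B s x) (outN G x)) (sym (fpos≡ x)))
    ; scanned-visited = scanned-visited′
    ; backward-balance = backward-balance′
    ; forward-balance = forward-balance
    ; successors-exits = λ a → trans (successors-exits a) (cong (λ k → take (k ∸ bit (skipped s a)) (exits s a)) (sym (fpos≡ a)))
    ; c-length = c-length }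
    , cong (_+ c s) (trans (Σᵥ-update u 1 (λ x x≢u → cong length (scanned-other x≢u))
                                          (trans (cong length scanned-cur) (length-∷ʳ (scanned s u) v)))
                           (+-comm _ 1))
    where
    open Invariant I
    s′ : State n
    s′ = moveBack s v
    u : Fin n
    u = cur s
    N : ℕ
    N = next s u

    length-∷ʳ : ∀ (xs : List (Fin n)) y → length (xs ∷ʳ y) ≡ length xs + 1
    length-∷ʳ xs y = length-++ xs

    unvisited≢cur : ∀ {x} → visited s x ≡ false → x ≢ u
    unvisited≢cur unvis refl = true≢false (trans (sym cur-visited) unvis)

    scanned-cur : scanned s′ u ≡ scanned s u ∷ʳ v
    scanned-cur = trans (cong (λ k → take k (inN G u)) (trans (update-same (next s) u (N + 1)) (+-comm N 1))) (sym scan≡)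

    scanned-other : ∀ {x} → x ≢ u → scanned s′ x ≡ scanned s x
    scanned-other x≢u = cong (λ k → take k (inN G _)) (update-other (next s) u _ x≢u)

    fpos≡ : ∀ x → fpos s′ x ≡ fpos s x
    fpos≡ x = case (x ≟ u)
      where
      case : Dec (x ≡ u) → fpos s′ x ≡ fpos s x
      case (yes refl) = trans (cong (_∸ d⁻ G u) (update-same (next s) u (N + 1)))
                          (trans (m≤n⇒m∸n≡0 (subst (_≤ d⁻ G u) (+-comm 1 N) N<d)) (sym (m≤n⇒m∸n≡0 (<⇒≤ N<d))))
      case (no x≢u) = cong (_∸ d⁻ G x) (update-other (next s) u _ x≢u)

    scanned-visited′ : ∀ x {y} → y ∈ scanned s′ x → visited s y ≡ true
    scanned-visited′ x {y} y∈ = case (x ≟ u)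
      where
      case : Dec (x ≡ u) → visited s y ≡ true
      case (no x≢u) = scanned-visited x (subst (y ∈_) (scanned-other x≢u) y∈)
      case (yes refl) with ∈-++⁻ (scanned s u) (subst (y ∈_) scanned-cur y∈)
      ... | inj₁ y∈old = scanned-visited u y∈old
      ... | inj₂ (here refl) = v-vis

    length-scanned : ∀ x → length (scanned s′ x) ≡ length (scanned s x) + δ u x
    length-scanned x = case (x ≟ u)
      where
      case : Dec (x ≡ u) → length (scanned s′ x) ≡ length (scanned s x) + δ u x
      case (yes refl) = trans (cong length scanned-cur)
                          (trans (length-∷ʳ (scanned s u) v) (cong (length (scanned s u) +_) (sym (δ-refl u))))
      case (no x≢u) = trans (cong length (scanned-other x≢u))
                        (sym (trans (cong (length (scanned s x) +_) (δ-≢ (x≢u ∘ sym))) (+-identityʳ _)))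

    backward-balance′ : ∀ x → Σᵥ (λ b → count x (scanned s′ b)) + δ trailEnd x ≡ length (scanned s′ x) + δ v x
    backward-balance′ x = begin
      Σᵥ (λ b → count x (scanned s′ b)) + δ trailEnd x       ≡⟨ cong (_+ δ trailEnd x) Σ≡ ⟩
      Σᵥ (λ b → count x (scanned s b)) + δ v x + δ trailEnd x ≡⟨ xy∙z≈xz∙y (Σᵥ (λ b → count x (scanned s b))) (δ v x) (δ trailEnd x) ⟩
      Σᵥ (λ b → count x (scanned s b)) + δ trailEnd x + δ v x ≡⟨ cong (_+ δ v x) (backward-balance x) ⟩
      length (scanned s x) + δ u x + δ v x                    ≡⟨ cong (_+ δ v x) (length-scanned x) ⟨
      length (scanned s′ x) + δ v x                           ∎
      where
      open ≡-Reasoning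
      Σ≡ : Σᵥ (λ b → count x (scanned s′ b)) ≡ Σᵥ (λ b → count x (scanned s b)) + δ v x
      Σ≡ = Σᵥ-update u (δ v x) (λ b b≢u → cong (count x) (scanned-other b≢u))
                              (trans (cong (count x) scanned-cur) (count-∷ʳ x (scanned s u) v))

  Progress : State n → Set
  Progress s = ∃ λ s′ → step G v0 s ≡ just s′ × Invariant s′ × potential s′ ≡ suc (potential s)

  back-progress : ∀ {s} → Invariant s → next s (cur s) < d⁻ G (cur s) → Progress s
  back-progress {s} I N<d = scan (nth-take (inN G u) N N<d)
    where
    u : Fin n
    u = cur s
    N : ℕ
    N = next s u

    scan : (∃ λ v → nth (inN G u) (suc N) ≡ just v × take (suc N) (inN G u) ≡ take N (inN G u) ∷ʳ v) → Progress s
    scan (v , nth≡ , take≡) with visited s v in v-vis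
    ... | true = moveBack s v , step≡ , moveBack-invariant I v-vis N<d (sym take≡)
      where
      step≡ : step G v0 s ≡ just (moveBack s v)
      step≡ = trans (step-back s N<d nth≡) (cong (λ b → just (if b then moveBack s v else moveBack (discover s v) v)) v-vis)
    ... | false = moveBack (discover s v) v , step≡ ,
                  moveBack-invariant (discover-invariant I v-vis u∈out) (update-same (visited s) v true) N<d (sym take≡)
      where
      step≡ : step G v0 s ≡ just (moveBack (discover s v) v)
      step≡ = trans (step-back s N<d nth≡) (cong (λ b → just (if b then moveBack s v else moveBack (discover s v) v)) v-vis)
      u∈out : u ∈ outN G v
      u∈out = count-pos⇒∈ (outN G v) (subst (0 <_) (sym (consistent G v u)) (∈⇒count-pos (nth-∈ (inN G u) N nth≡)))

  exitState-next-other : ∀ s t y {x} → x ≢ cur s → next (exitState s t y) x ≡ next s x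
  exitState-next-other s true y x≢u = update-other (next s) (cur s) _ x≢u
  exitState-next-other s false y x≢u = update-other (next s) (cur s) _ x≢u

  exitState-next-cur : ∀ s t y → next (exitState s t y) (cur s) ≡ (if t then next s (cur s) + 1 + 1 else next s (cur s) + 1)
  exitState-next-cur s true y = update-same (next s) (cur s) _
  exitState-next-cur s false y = update-same (next s) (cur s) _

  exitState-skipped-other : ∀ s t y {x} → x ≢ cur s → skipped (exitState s t y) x ≡ skipped s x
  exitState-skipped-other s true y x≢u = update-other (skipped s) (cur s) true x≢u
  exitState-skipped-other s false y x≢u = refl

  exitState-skipped-cur : ∀ s t y → skipped (exitState s t y) (cur s) ≡ (skipped s (cur s) ∨ t)
  exitState-skipped-cur s true y = trans (update-same (skipped s) (cur s) true) (sym (∨-zeroʳ (skipped s (cur s))))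
  exitState-skipped-cur s false y = sym (∨-identityʳ (skipped s (cur s)))

  exitState-visited : ∀ s t y → visited (exitState s t y) ≡ visited s
  exitState-visited s true y = refl
  exitState-visited s false y = refl

  exitState-B : ∀ s t y → B (exitState s t y) ≡ B s
  exitState-B s true y = refl
  exitState-B s false y = refl

  exit-invariant : ∀ {s t y} (I : Invariant s) → let u = cur s ; s′ = exitState s t y in
                   d⁻ G u ≤ next s u → u ≡ Invariant.trailEnd I → visited s y ≡ true →
                   skipped s′ u ≡ skipFlag (B s u) (outN G u) (fpos s′ u) →
                   emitted s′ u ≡ suc (emitted s u) →
                   nth (exits s u) (suc (emitted s u)) ≡ just y →
                   Invariant s′ × potential s′ ≡ suc (potential s)
  exit-invariant {s} {t} {y} I out-phase u≡end y-vis flag emitted-suc pick = record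
    { depth = depth
    ; trailEnd = y
    ; cur-visited = trans (vis≡ y) y-vis
    ; root-visited = trans (vis≡ v0) root-visited
    ; unvisited-fresh = λ x unvis → let unvis′ = trans (sym (vis≡ x)) unvis in
                          trans (exitState-next-other s t y (unvisited≢cur unvis′)) (unvisited-fresh x unvis′)
    ; root-orphan = trans (B≡ v0) root-orphan
    ; has-parent = λ x vis x≢v0 → let p , eq = has-parent x (trans (sym (vis≡ x)) vis) x≢v0 in p , trans (B≡ x) eq
    ; parent-edge = λ x eq → let p∈ , p-vis , p<x = parent-edge x (trans (sym (B≡ x)) eq) in p∈ , trans (vis≡ _) p-vis , p<x
    ; skip-flag = skip-flag′
    ; scanned-visited = λ x y∈ → trans (vis≡ _) (scanned-visited x (subst (_ ∈_) (scanned≡ x) y∈))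
    ; backward-balance = backward-balance′
    ; forward-balance = forward-balance′
    ; successors-exits = successors-exits′
    ; c-length = trans (+-comm (c s) 1) (trans (cong suc c-length) (sym (trans (length-++ (output s)) (+-comm _ 1)))) }
    , potential≡
    where
    open Invariant I
    u : Fin n
    u = cur s
    s′ : State n
    s′ = exitState s t y

    vis≡ : ∀ x → visited s′ x ≡ visited s x
    vis≡ x = cong (λ f → f x) (exitState-visited s t y)

    B≡ : ∀ x → B s′ x ≡ B s x
    B≡ x = cong (λ f → f x) (exitState-B s t y)

    unvisited≢cur : ∀ {x} → visited s x ≡ false → x ≢ u
    unvisited≢cur unvis refl = true≢false (trans (sym cur-visited) unvis)

    fpos-other : ∀ {x} → x ≢ u → fpos s′ x ≡ fpos s x
    fpos-other x≢u = cong (_∸ d⁻ G _) (exitState-next-other s t y x≢u)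

    out-phase′ : d⁻ G u ≤ next s′ u
    out-phase′ = subst (d⁻ G u ≤_) (sym (exitState-next-cur s t y)) (grows t)
      where
      grows : ∀ b → d⁻ G u ≤ (if b then next s u + 1 + 1 else next s u + 1)
      grows true = ≤-trans out-phase (≤-trans (m≤m+n _ 1) (m≤m+n _ 1))
      grows false = ≤-trans out-phase (m≤m+n _ 1)

    scanned≡ : ∀ x → scanned s′ x ≡ scanned s x
    scanned≡ x = case (x ≟ u)
      where
      case : Dec (x ≡ u) → scanned s′ x ≡ scanned s x
      case (yes refl) = trans (take-all _ (inN G u) out-phase′) (sym (take-all _ (inN G u) out-phase))
      case (no x≢u) = cong (λ k → take k (inN G x)) (exitState-next-other s t y x≢u)

    skip-flag′ : ∀ x → skipped s′ x ≡ skipFlag (B s′ x) (outN G x) (fpos s′ x)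
    skip-flag′ x = case (x ≟ u)
      where
      case : Dec (x ≡ u) → skipped s′ x ≡ skipFlag (B s′ x) (outN G x) (fpos s′ x)
      case (yes refl) = trans flag (cong (λ mb → skipFlag mb (outN G u) (fpos s′ u)) (sym (B≡ u)))
      case (no x≢u) = trans (exitState-skipped-other s t y x≢u)
                        (trans (skip-flag x) (cong₂ (λ mb f → skipFlag mb (outN G x) f) (sym (B≡ x)) (sym (fpos-other x≢u))))

    backward-balance′ : ∀ x → Σᵥ (λ b → count x (scanned s′ b)) + δ y x ≡ length (scanned s′ x) + δ y x
    backward-balance′ x = begin
      Σᵥ (λ b → count x (scanned s′ b)) + δ y x  ≡⟨ cong (_+ δ y x) (sum-map-cong (allV n) (λ b → cong (count x) (scanned≡ b))) ⟩
      Σᵥ (λ b → count x (scanned s b)) + δ y x   ≡⟨ cong (_+ δ y x) Σ≡length ⟩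
      length (scanned s x) + δ y x               ≡⟨ cong (λ l → length l + δ y x) (scanned≡ x) ⟨
      length (scanned s′ x) + δ y x              ∎
      where
      open ≡-Reasoning
      Σ≡length : Σᵥ (λ b → count x (scanned s b)) ≡ length (scanned s x)
      Σ≡length = +-cancelʳ-≡ (δ u x) _ _ (trans (cong (λ e → _ + δ e x) u≡end) (backward-balance x))

    length-successors : ∀ x → length (successors x (output s′)) ≡ length (successors x (output s)) + δ u x
    length-successors x = case (x ≟ u)
      where
      case : Dec (x ≡ u) → length (successors x (output s′)) ≡ length (successors x (output s)) + δ u x
      case (yes refl) = trans (cong length (successors-∷ʳ-same u y (output s)))
                          (trans (length-++ (successors u (output s))) (cong (length (successors u (output s)) +_) (sym (δ-refl u))))
      case (no x≢u) = trans (cong length (successors-∷ʳ-other y (output s) x≢u))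
                        (sym (trans (cong (length (successors x (output s)) +_) (δ-≢ (x≢u ∘ sym))) (+-identityʳ _)))

    forward-balance′ : ∀ x → Σᵥ (λ a → count x (successors a (output s′))) + δ v0 x
                             ≡ length (successors x (output s′)) + δ y x
    forward-balance′ x = begin
      Σᵥ (λ a → count x (successors a (output s′))) + δ v0 x      ≡⟨ cong (_+ δ v0 x) Σ≡ ⟩
      Σᵥ (λ a → count x (successors a (output s))) + δ y x + δ v0 x ≡⟨ xy∙z≈xz∙y _ (δ y x) (δ v0 x) ⟩
      Σᵥ (λ a → count x (successors a (output s))) + δ v0 x + δ y x ≡⟨ cong (_+ δ y x) (forward-balance x) ⟩
      length (successors x (output s)) + δ trailEnd x + δ y x      ≡⟨ cong (λ e → length (successors x (output s)) + δ e x + δ y x) u≡end ⟨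
      length (successors x (output s)) + δ u x + δ y x             ≡⟨ cong (_+ δ y x) (length-successors x) ⟨
      length (successors x (output s′)) + δ y x                    ∎
      where
      open ≡-Reasoning
      Σ≡ : Σᵥ (λ a → count x (successors a (output s′))) ≡ Σᵥ (λ a → count x (successors a (output s))) + δ y x
      Σ≡ = Σᵥ-update u (δ y x) (λ a a≢u → cong (count x) (successors-∷ʳ-other y (output s) a≢u))
             (trans (cong (count x) (successors-∷ʳ-same u y (output s))) (count-∷ʳ x (successors u (output s)) y))

    successors-exits′ : ∀ a → successors a (output s′) ≡ take (emitted s′ a) (exitOrder (B s′ a) (outN G a))
    successors-exits′ a = case (a ≟ u)
      where
      case : Dec (a ≡ u) → successors a (output s′) ≡ take (emitted s′ a) (exitOrder (B s′ a) (outN G a))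
      case (yes refl) = begin
        successors u (output s′)                             ≡⟨ successors-∷ʳ-same u y (output s) ⟩
        successors u (output s) ∷ʳ y                         ≡⟨ cong (_∷ʳ y) (successors-exits u) ⟩
        take (emitted s u) (exits s u) ∷ʳ y                  ≡⟨ take-suc-nth (exits s u) (emitted s u) pick ⟨
        take (suc (emitted s u)) (exits s u)                 ≡⟨ cong₂ (λ k mb → take k (exitOrder mb (outN G u))) (sym emitted-suc) (sym (B≡ u)) ⟩
        take (emitted s′ u) (exitOrder (B s′ u) (outN G u))  ∎
        where open ≡-Reasoning
      case (no a≢u) = trans (successors-∷ʳ-other y (output s) a≢u)
                        (trans (successors-exits a)
                          (cong₂ (λ k mb → take k (exitOrder mb (outN G a)))
                                 (sym (cong₂ _∸_ (fpos-other a≢u) (cong bit (exitState-skipped-other s t y a≢u))))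
                                 (sym (B≡ a))))

    potential≡ : potential s′ ≡ suc (potential s)
    potential≡ = trans (cong₂ _+_ (sum-map-cong (allV n) (λ x → cong length (scanned≡ x))) (+-comm (c s) 1))
                       (+-suc _ (c s))

  module _ {s : State n} (I : Invariant s) where
    open Invariant I

    Exhausted : Fin n → Set
    Exhausted a = length (exits s a) ≤ emitted s a

    InEdgesUsed : Fin n → Set
    InEdgesUsed x = ∀ a → count x (successors a (output s)) ≡ count x (outN G a)

    exits-count : ∀ a b → count b (exits s a) ≡ count b (outN G a)
    exits-count a b = exitOrder-count (B s a) (outN G a) b (λ eq → proj₁ (parent-edge a eq))

    exits-length : ∀ a → length (exits s a) ≡ d⁺ G a
    exits-length a = exitOrder-length (B s a) (outN G a) (λ eq → proj₁ (parent-edge a eq))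

    exhausted-successors : ∀ {a} → Exhausted a → successors a (output s) ≡ exits s a
    exhausted-successors {a} done = trans (successors-exits a) (take-all (emitted s a) (exits s a) done)

    successors-count≤ : ∀ a b → count b (successors a (output s)) ≤ count b (outN G a)
    successors-count≤ a b = begin
      count b (successors a (output s))       ≡⟨ cong (count b) (successors-exits a) ⟩
      count b (take (emitted s a) (exits s a)) ≤⟨ count-take≤ b (emitted s a) (exits s a) ⟩
      count b (exits s a)                     ≡⟨ exits-count a b ⟩
      count b (outN G a)                      ∎
      where open ≤-Reasoning

    received≤in-degree : ∀ x → Σᵥ (λ a → count x (successors a (output s))) ≤ d⁻ G x
    received≤in-degree x = ≤-trans (sum-map-mono (allV n) (λ a → successors-count≤ a x)) (≤-reflexive (Σᵥ-count-outN G x))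

    in-edges-used : ∀ x → d⁻ G x ≤ Σᵥ (λ a → count x (successors a (output s))) → InEdgesUsed x
    in-edges-used x full a = sum-map-≤-tight (allV n) (λ a → successors-count≤ a x)
                               (≤-trans (≤-reflexive (Σᵥ-count-outN G x)) full) (allV-complete a)

  module _ (balanced : ∀ v → d⁺ G v ≡ d⁻ G v) {s : State n} (I : Invariant s) where
    open Invariant I
    private
      u : Fin n
      u = cur s

    out-phase⇒at-trailEnd : d⁻ G u ≤ next s u →
                            u ≡ trailEnd × (∀ b → count u (scanned s b) ≡ count u (inN G b))
    out-phase⇒at-trailEnd out-phase = case (trailEnd ≟ u)
      where
      S : ℕ
      S = Σᵥ (λ b → count u (scanned s b))

      S≤ : S ≤ d⁻ G u
      S≤ = ≤-trans (sum-map-mono (allV n) (λ b → count-take≤ u (next s b) (inN G b)))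
                   (≤-reflexive (trans (Σᵥ-count-inN G u) (balanced u)))

      S+δ≡ : S + δ trailEnd u ≡ d⁻ G u + 1
      S+δ≡ = trans (backward-balance u) (cong₂ _+_ (cong length (take-all (next s u) (inN G u) out-phase)) (δ-refl u))

      case : Dec (trailEnd ≡ u) → u ≡ trailEnd × (∀ b → count u (scanned s b) ≡ count u (inN G b))
      case (no end≢u) = ⊥-elim (<⇒≱ (≤-reflexive (trans (+-comm 1 (d⁻ G u)) (sym S≡))) S≤)
        where
        S≡ : S ≡ d⁻ G u + 1
        S≡ = trans (sym (+-identityʳ S)) (trans (cong (S +_) (sym (δ-≢ end≢u))) S+δ≡)
      case (yes refl) = refl , λ b →
        sum-map-≤-tight (allV n) (λ b → count-take≤ u (next s b) (inN G b)) Σin≤S (allV-complete b)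
        where
        Σin≤S : Σᵥ (λ b → count u (inN G b)) ≤ S
        Σin≤S = ≤-reflexive (trans (Σᵥ-count-inN G u) (trans (balanced u)
                  (+-cancelʳ-≡ 1 _ _ (sym (trans (cong (S +_) (sym (δ-refl u))) S+δ≡)))))

    exit-target-visited : d⁻ G u ≤ next s u → ∀ {y} → y ∈ outN G u → visited s y ≡ true
    exit-target-visited out-phase {y} y∈out with visited s y in y-vis
    ... | true = refl
    ... | false = ⊥-elim (<⇒≢ (∈⇒count-pos y∈out) (sym (begin
      count y (outN G u)                     ≡⟨ consistent G u y ⟩
      count u (inN G y)                      ≡⟨ proj₂ (out-phase⇒at-trailEnd out-phase) y ⟨
      count u (take (next s y) (inN G y))    ≡⟨ cong (λ k → count u (take k (inN G y))) (unvisited-fresh y y-vis) ⟩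
      0                                      ∎)))
      where open ≡-Reasoning

    emitted<exits-off-root : u ≡ trailEnd → u ≢ v0 → emitted s u < length (exits s u)
    emitted<exits-off-root u≡end u≢v0 = ≰⇒> not-exhausted
      where
      R : ℕ
      R = Σᵥ (λ a → count u (successors a (output s)))
      L : ℕ
      L = length (successors u (output s))

      R≡ : R ≡ suc L
      R≡ = begin
        R                        ≡⟨ +-identityʳ R ⟨
        R + 0                    ≡⟨ cong (R +_) (δ-≢ (u≢v0 ∘ sym)) ⟨
        R + δ v0 u               ≡⟨ forward-balance u ⟩
        L + δ trailEnd u         ≡⟨ cong (λ e → L + δ e u) u≡end ⟨
        L + δ u u                ≡⟨ cong (L +_) (δ-refl u) ⟩
        L + 1                    ≡⟨ +-comm L 1 ⟩
        suc L                    ∎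
        where open ≡-Reasoning
      not-exhausted : ¬ Exhausted I u
      not-exhausted done = <⇒≱ (begin-strict
        length (exits s u)                              ≡⟨ cong length (exhausted-successors I done) ⟨
        L                                               <⟨ ≤-reflexive (sym R≡) ⟩
        R                                               ≤⟨ received≤in-degree I u ⟩
        d⁻ G u                                          ≡⟨ trans (sym (balanced u)) (sym (exits-length I u)) ⟩
        length (exits s u)                              ∎) ≤-refl
        where open ≤-Reasoning

    module _ (end≡root : trailEnd ≡ v0) (root-exhausted : Exhausted I v0) where

      exhausted⇒in-edges-used : ∀ {x} → Exhausted I x → InEdgesUsed I x
      exhausted⇒in-edges-used {x} done = in-edges-used I x (≤-reflexive (sym (+-cancelʳ-≡ (δ v0 x) _ _ (begin
        Σᵥ (λ a → count x (successors a (output s))) + δ v0 x  ≡⟨ forward-balance x ⟩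
        length (successors x (output s)) + δ trailEnd x         ≡⟨ cong₂ (λ l e → length l + δ e x) (exhausted-successors I done) end≡root ⟩
        length (exits s x) + δ v0 x                             ≡⟨ cong (_+ δ v0 x) (trans (exits-length I x) (balanced x)) ⟩
        d⁻ G x + δ v0 x                                         ∎))))
        where open ≡-Reasoning

      child-exhausted : ∀ {x p} → B s x ≡ just p → InEdgesUsed I p → Exhausted I x
      child-exhausted {x} {p} B≡ p-used = subst (λ mb → length (exitOrder mb (outN G x)) ≤ emitted s x) (sym B≡)
        (parent-last p (outN G x) (emitted s x) (begin
          count p (take (emitted s x) σ)       ≡⟨ cong (λ mb → count p (take (emitted s x) (exitOrder mb (outN G x)))) B≡ ⟨
          count p (take (emitted s x) (exits s x)) ≡⟨ cong (count p) (successors-exits x) ⟨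
          count p (successors x (output s))    ≡⟨ p-used x ⟩
          count p (outN G x)                   ≡⟨ exitOrder-count (just p) (outN G x) p (λ { refl → proj₁ (parent-edge x B≡) }) ⟨
          count p σ                            ∎))
        where
        open ≡-Reasoning
        σ = exitOrder (just p) (outN G x)

      visited⇒exhausted : ∀ x → visited s x ≡ true → Exhausted I x
      visited⇒exhausted x = by-depth (suc (depth x)) x ≤-refl
        where
        by-depth : ∀ r x → depth x < r → visited s x ≡ true → Exhausted I x
        by-depth (suc r) x x<r x-vis with x ≟ v0
        ... | yes refl = root-exhausted
        ... | no x≢v0 with has-parent x x-vis x≢v0
        ... | p , B≡ with parent-edge x B≡
        ... | _ , p-vis , p<x =
          child-exhausted B≡ (exhausted⇒in-edges-used (by-depth r p (≤-trans p<x (s≤s⁻¹ x<r)) p-vis))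

      reaches-root⇒visited : ∀ {x} → Reach G x v0 → visited s x ≡ true
      reaches-root⇒visited here = root-visited
      reaches-root⇒visited {x} (there {w = w} w∈out path) = scanned-visited w (subst (x ∈_) (sym all-scanned) x∈in)
        where
        w-done : Exhausted I w
        w-done = visited⇒exhausted w (reaches-root⇒visited path)
        x∈in : x ∈ inN G w
        x∈in = count-pos⇒∈ (inN G w) (subst (0 <_) (consistent G x w) (∈⇒count-pos w∈out))
        fpos-pos : 0 < fpos s w
        fpos-pos = begin-strict
          0                     <⟨ ∈⇒count-pos x∈in ⟩
          count x (inN G w)     ≤⟨ count≤length x (inN G w) ⟩
          d⁻ G w                ≡⟨ trans (sym (balanced w)) (sym (exits-length I w)) ⟩
          length (exits s w)    ≤⟨ w-done ⟩
          emitted s w           ≤⟨ m∸n≤m (fpos s w) (bit (skipped s w)) ⟩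
          fpos s w              ∎
          where open ≤-Reasoning
        all-scanned : scanned s w ≡ inN G w
        all-scanned = take-all (next s w) (inN G w) (<⇒≤ (m∸n≢0⇒n<m (>⇒≢ fpos-pos)))

      all-emitted : (∀ x → Reach G x v0) → edges G ≤ c s
      all-emitted to-root = ≤-reflexive (begin
        edges G                                      ≡⟨ sum-map-cong (allV n) length-successors ⟨
        Σᵥ (λ a → length (successors a (output s)))  ≡⟨ Σᵥ-length-successors (output s) ⟩
        length (output s)                            ≡⟨ c-length ⟨
        c s                                          ∎)
        where
        open ≡-Reasoning
        length-successors : ∀ a → length (successors a (output s)) ≡ d⁺ G a
        length-successors a = trans (cong length (exhausted-successors I (visited⇒exhausted a (reaches-root⇒visited (to-root a)))))
                                    (exits-length I a)

    exit-progress : (∀ x → Reach G x v0) → c s < edges G → d⁻ G u ≤ next s u → Progress s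
    exit-progress to-root c<m out-phase =
      exitState s t y , step≡ , exit-invariant {s} {t} {y} I out-phase u≡end y-visited flag′ emitted-suc nth≡
      where
      u≡end : u ≡ trailEnd
      u≡end = proj₁ (out-phase⇒at-trailEnd out-phase)
      l : List (Fin n)
      l = outN G u
      mb : Maybe (Fin n)
      mb = B s u
      sk : Bool
      sk = skipped s u
      f : ℕ
      f = fpos s u
      k : ℕ
      k = emitted s u

      k<exits : k < length (exits s u)
      k<exits with u ≟ v0
      ... | no u≢v0 = emitted<exits-off-root u≡end u≢v0
      ... | yes refl = ≰⇒> (λ done → <⇒≱ c<m (all-emitted (sym u≡end) done to-root))

      E : ExitStep l mb (exits s u) (skipFlag mb l) sk f
      E = exitStep l mb sk f (λ eq → proj₁ (parent-edge u eq)) (skip-flag u) (subst (k <_) (exits-length I u) k<exits)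
      open ExitStep E

      y : Fin n
      y = proj₁ (nth-take (exits s u) k k<exits)
      nth≡ : nth (exits s u) (suc k) ≡ just y
      nth≡ = proj₁ (proj₂ (nth-take (exits s u) k k<exits))

      y-visited : visited s y ≡ true
      y-visited = exit-target-visited out-phase
                    (count-pos⇒∈ l (subst (0 <_) (exits-count I u y) (∈⇒count-pos (nth-∈ (exits s u) k nth≡))))

      t : Bool
      t = skipTest l mb sk (suc f)

      i≡ : next s u + 1 ∸ d⁻ G u ≡ suc f
      i≡ = trans (+-∸-comm 1 out-phase) (+-comm f 1)

      step≡ : step G v0 s ≡ just (exitState s t y)
      step≡ = trans (subst (λ i → step G v0 s ≡ (exitPick l mb sk i >>= λ v → just (exitState s (skipTest l mb sk i) v)))
                           i≡ (step-exit s (≤ᵇ-false (subst (d⁻ G u <_) (+-comm 1 (next s u)) (s≤s out-phase)))))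
                    (cong (_>>= λ v → just (exitState s t v)) (trans pick≡ nth≡))

      fpos′ : fpos (exitState s t y) u ≡ exitIndex l mb sk (suc f)
      fpos′ = trans (cong (_∸ d⁻ G u) (exitState-next-cur s t y)) (advance t)
        where
        advance : ∀ b → (if b then next s u + 1 + 1 else next s u + 1) ∸ d⁻ G u ≡ (if b then suc f + 1 else suc f)
        advance true = trans (+-∸-comm 1 (≤-trans out-phase (m≤m+n _ 1))) (cong (_+ 1) i≡)
        advance false = i≡

      flag′ : skipped (exitState s t y) u ≡ skipFlag mb l (fpos (exitState s t y) u)
      flag′ = trans (exitState-skipped-cur s t y) (trans flag≡ (cong (skipFlag mb l) (sym fpos′)))

      emitted-suc : emitted (exitState s t y) u ≡ suc k
      emitted-suc = trans (cong₂ _∸_ fpos′ (cong bit (exitState-skipped-cur s t y))) index≡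

  step-progress : (∀ v → d⁺ G v ≡ d⁻ G v) → (∀ x → Reach G x v0) →
                  ∀ {s} → Invariant s → c s < edges G → Progress s
  step-progress balanced to-root {s} I c<m with next s (cur s) <? d⁻ G (cur s)
  ... | yes in-phase = back-progress I in-phase
  ... | no out-phase = exit-progress balanced I to-root c<m (≮⇒≥ out-phase)

  run-continue : ∀ k s → c s < edges G → run G v0 (suc k) s ≡ (step G v0 s >>= run G v0 k)
  run-continue k s c<m with c s <ᵇ edges G in guard
  ... | true = refl
  ... | false = ⊥-elim (subst T guard (<⇒<ᵇ c<m))

  run-halt : ∀ k s → ¬ c s < edges G → run G v0 (suc k) s ≡ just s
  run-halt k s c≮m with c s <ᵇ edges G in guard
  ... | true = ⊥-elim (c≮m (<ᵇ-true⁻¹ guard))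
  ... | false = refl

  potential≤ : (∀ v → d⁺ G v ≡ d⁻ G v) → ∀ s → potential s ≤ edges G + c s
  potential≤ balanced s = +-monoˡ-≤ (c s) (sum-map-mono (allV n) scanned≤out-degree)
    where
    scanned≤out-degree : ∀ x → length (scanned s x) ≤ d⁺ G x
    scanned≤out-degree x = ≤-trans (≤-reflexive (length-take (next s x) (inN G x)))
                                   (≤-trans (m⊓n≤n _ _) (≤-reflexive (sym (balanced x))))

  module _ (balanced : ∀ v → d⁺ G v ≡ d⁻ G v) (to-root : ∀ x → Reach G x v0) where

    run-progress : ∀ k {s} → Invariant s →
                   ∃ λ s′ → run G v0 k s ≡ just s′ × (edges G ≤ c s′ ⊎ potential s′ ≡ potential s + k)
    run-progress zero {s} I = s , refl , inj₂ (sym (+-identityʳ _))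
    run-progress (suc k) {s} I with c s <? edges G
    ... | no c≮m = s , run-halt k s c≮m , inj₁ (≮⇒≥ c≮m)
    ... | yes c<m with step-progress balanced to-root I c<m
    ... | s₁ , step≡ , I₁ , pot₁ with run-progress k I₁
    ... | s′ , run≡ , result = s′ , trans (run-continue k s c<m) (trans (cong (_>>= run G v0 k) step≡) run≡) ,
                               map₂ (λ pot′ → trans pot′ (trans (cong (_+ k) pot₁) (sym (+-suc _ k)))) result

    run-terminates : ∃ λ s′ → run G v0 (edges G + edges G) (init v0) ≡ just s′ × edges G ≤ c s′
    run-terminates with run-progress (edges G + edges G) init-invariant
    ... | s′ , run≡ , inj₁ done = s′ , run≡ , done
    ... | s′ , run≡ , inj₂ pot≡ with edges G ≤? c s′
    ...   | yes done = s′ , run≡ , done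
    ...   | no c≱m = ⊥-elim (<⇒≱ (+-monoʳ-< (edges G) (≰⇒> c≱m)) (begin
            edges G + edges G                          ≡⟨ cong (_+ (edges G + edges G)) init-potential ⟨
            potential (init v0) + (edges G + edges G)  ≡⟨ pot≡ ⟨
            potential s′                               ≤⟨ potential≤ balanced s′ ⟩
            edges G + c s′                             ∎))
      where
      open ≤-Reasoning
      init-potential : potential (init v0) ≡ 0
      init-potential = trans (+-identityʳ _) (sum-map-0 (allV n))

n+2m≤3m+3 : ∀ n m → n ≤ m + 1 → n + (m + m) ≤ 3 * m + 3
n+2m≤3m+3 n m n≤m+1 = begin
  n + (m + m)        ≤⟨ +-monoˡ-≤ (m + m) n≤m+1 ⟩
  m + 1 + (m + m)    ≡⟨ solve 1 (λ m → m :+ con 1 :+ (m :+ m) := con 3 :* m :+ con 1) refl m ⟩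
  3 * m + 1          ≤⟨ +-monoʳ-≤ (3 * m) (s≤s z≤n) ⟩
  3 * m + 3          ∎
  where
  open ≤-Reasoning
  open +-*-Solver

theorem12 : ∃ λ (C : ℕ) → ∀ (n : ℕ) (G : Graph n) → Eulerian G → (v0 : Fin n) →
    ∃ λ (k : ℕ) → (n + k ≤ C * edges G + C) ×
      (∃ λ (s : State n) → (run G v0 k (init v0) ≡ just s) × (edges G ≤ c s))
theorem12 = 3 , λ n G (strong , balanced) v0 →
  edges G + edges G ,
  n+2m≤3m+3 n (edges G) (vertices≤edges+1 G strong) ,
  Algorithm.run-terminates G v0 balanced (λ x → strong x v0)
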